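{- Let $\mathcal{E}$ be a set of extension axioms, $Q$ an $\mathsf{NB}$ query and $b\in\{0,1\}$. There is a winning strategy in $\mathsf{NB}^{\mathrm{DM}}$ over $\mathcal{E}$ from the state $\{Q^{\mathrm{DM}}\mapsto b,\ (\neg Q)^{\mathrm{DM}}\mapsto b\}$ with $O(\log |Q|_{\mathrm{eNDT}})$ rounds.
   Context: eNDT formulas: $A::=0\mid1\mid ApB\mid A\lor B\mid e_i$ ($p$ propositional variable, $e_i$ extension variables; $p$ is identified with $0p1$). $\mathcal{E}=\{e_i\leftrightarrow E_i\}_{i<n}$ with $E_i$ mentioning only $e_0,\dots,e_{i-1}$. Simulation $A\succeq_\mathcal{E}B$: smallest relation with $A\succeq A$; $A\succeq C,A\succeq D\Rightarrow A\succeq C\lor D$; $A\succeq E_i\Rightarrow A\succeq e_i$; $A\succeq C,B\succeq D\Rightarrow ApB\succeq CpD$; $A_j\succeq B\Rightarrow A_0\lor A_1\succeq B$; $E_i\succeq B\Rightarrow e_i\succeq B$. $\mathsf{NB}$ queries: $Q::=A\mid\neg Q\mid Q\lor R\mid Q\land R$ ($A$ eNDT). $\mathsf{NB}^{\mathrm{DM}}$ over $\mathcal{E}$ is the game with queries $Q::=A\mid\neg A\mid Q\lor R\mid Q\land R$ ($A$ eNDT) and simple contradictions: $\{0\mapsto1\}$, $\{1\mapsto0\}$; $\{A_0\mapsto b_0,A_1\mapsto b_1,p\mapsto i,A_0pA_1\mapsto c\}$ with $c\ne b_i$; $\{A\mapsto b,\neg A\mapsto b\}$; sets inconsistent with the truth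 tables of $\lor,\land$; $\{e_i\mapsto b,E_i\mapsto1-b\}$; $\{A\mapsto0,B\mapsto1\}$ whenever $A\succeq_\mathcal{E}B$. A winning strategy from a state $S$ is a finite binary tree with internal nodes labelled by queries and edges labelled $0,1$ such that along every root-to-leaf path $S$ plus the assignments made contains a simple contradiction; rounds = depth. De Morgan translation: $B^{\mathrm{DM}}=B$, $(Q\land R)^{\mathrm{DM}}=Q^{\mathrm{DM}}\land R^{\mathrm{DM}}$, $(Q\lor R)^{\mathrm{DM}}=Q^{\mathrm{DM}}\lor R^{\mathrm{DM}}$, $(\neg B)^{\mathrm{DM}}=\neg B$, $(\neg\neg Q)^{\mathrm{DM}}=Q^{\mathrm{DM}}$, $(\neg(Q\lor R))^{\mathrm{DM}}=(\neg Q)^{\mathrm{DM}}\land(\neg R)^{\mathrm{DM}}$, $(\neg(Q\land R))^{\mathrm{DM}}=(\neg Q)^{\mathrm{DM}}\lor(\neg R)^{\mathrm{DM}}$, for $B$ eNDT. $|Q|_{\mathrm{eNDT}}$ is the number of occurrences of maximal eNDT subformulas in $Q$ (leaves of the Boolean skeleton of $Q$). -}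

module Defs where

open import Data.Nat using (ℕ; _+_; _*_; _<_; suc; _⊔_)
open import Data.Unit using (⊤)
open import Data.Bool using (Bool; true; false; T; not; _∧_; _∨_; if_then_else_)
open import Data.Product using (_×_; _,_)
open import Data.List using (List; _∷_; length; lookup)
open import Data.List.Membership.Propositional using (_∈_)
open import Data.Fin using (Fin; toℕ)
open import Relation.Binary.PropositionalEquality using (_≡_; _≢_)

-- A single term syntax covering eNDT formulas, NB queries and
-- NB^DM queries (the grammars of the paper are sub-grammars of it; an
-- expression such as A ∨ B with A, B eNDT is one and the same term
-- whether read as an eNDT formula or as a query).

data Tm : Set where
  t0   : Tm
  t1   : Tm
  nd   : Tm → ℕ → Tm → Tm      -- A p B   (variable p is  nd t0 p t1)
  ext  : ℕ → Tm
  lor  : Tm → Tm → Tm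
  land : Tm → Tm → Tm
  lneg : Tm → Tm

var : ℕ → Tm
var p = nd t0 p t1

isE : Tm → Bool
isE t0 = true
isE t1 = true
isE (nd A p B) = isE A ∧ isE B
isE (ext i) = true
isE (lor A B) = isE A ∧ isE B
isE (land _ _) = false
isE (lneg _) = false

IsENDT : Tm → Set
IsENDT t = T (isE t)

data IsNB : Tm → Set where
  atom : ∀ {A} → IsENDT A → IsNB A
  neg  : ∀ {Q} → IsNB Q → IsNB (lneg Q)
  or   : ∀ {Q R} → IsNB Q → IsNB R → IsNB (lor Q R)
  and  : ∀ {Q R} → IsNB Q → IsNB R → IsNB (land Q R)

data IsDM : Tm → Set where
  atom : ∀ {A} → IsENDT A → IsDM A
  negA : ∀ {A} → IsENDT A → IsDM (lneg A)
  or   : ∀ {Q R} → IsDM Q → IsDM R → IsDM (lor Q R)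
  and  : ∀ {Q R} → IsDM Q → IsDM R → IsDM (land Q R)

ExtBelow : ℕ → Tm → Set
ExtBelow k t0 = ⊤
ExtBelow k t1 = ⊤
ExtBelow k (nd A p B) = ExtBelow k A × ExtBelow k B
ExtBelow k (ext j) = j < k
ExtBelow k (lor A B) = ExtBelow k A × ExtBelow k B
ExtBelow k (land A B) = ExtBelow k A × ExtBelow k B
ExtBelow k (lneg A) = ExtBelow k A

-- A set of extension axioms {e_i ↔ E_i}_{i<n} is the list E_0,…,E_{n-1};
-- each E_i is an eNDT formula mentioning only e_0,…,e_{i-1}.
ExtAxioms : Set
ExtAxioms = List Tm

WellFormed : ExtAxioms → Set
WellFormed ℰ = (i : Fin (length ℰ)) → IsENDT (lookup ℰ i) × ExtBelow (toℕ i) (lookup ℰ i)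

data Sim (ℰ : ExtAxioms) : Tm → Tm → Set where
  refl′  : ∀ {A} → Sim ℰ A A
  orR    : ∀ {A C D} → Sim ℰ A C → Sim ℰ A D → Sim ℰ A (lor C D)
  extR   : ∀ {A} (i : Fin (length ℰ)) → Sim ℰ A (lookup ℰ i) → Sim ℰ A (ext (toℕ i))
  node   : ∀ {A B C D p} → Sim ℰ A C → Sim ℰ B D → Sim ℰ (nd A p B) (nd C p D)
  orL₀   : ∀ {A₀ A₁ B} → Sim ℰ A₀ B → Sim ℰ (lor A₀ A₁) B
  orL₁   : ∀ {A₀ A₁ B} → Sim ℰ A₁ B → Sim ℰ (lor A₀ A₁) B
  extL   : ∀ {B} (i : Fin (length ℰ)) → Sim ℰ (lookup ℰ i) B → Sim ℰ (ext (toℕ i)) B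

-- Game states and simple contradictions of NB^DM over ℰ
-- (false = 0, true = 1)

State : Set
State = List (Tm × Bool)

data Contra (ℰ : ExtAxioms) (S : State) : Set where
  c-zero : (t0 , true) ∈ S → Contra ℰ S
  c-one  : (t1 , false) ∈ S → Contra ℰ S
  c-node : ∀ {A₀ A₁ p b₀ b₁ i c} →
           (A₀ , b₀) ∈ S → (A₁ , b₁) ∈ S → (var p , i) ∈ S →
           (nd A₀ p A₁ , c) ∈ S → c ≢ (if i then b₁ else b₀) → Contra ℰ S
  c-neg  : ∀ {A b} → (A , b) ∈ S → (lneg A , b) ∈ S → Contra ℰ S
  c-or1  : ∀ {Q R} → (lor Q R , true) ∈ S → (Q , false) ∈ S → (R , false) ∈ S → Contra ℰ S
  c-or0l : ∀ {Q R} → (lor Q R , false) ∈ S → (Q , true) ∈ S → Contra ℰ S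
  c-or0r : ∀ {Q R} → (lor Q R , false) ∈ S → (R , true) ∈ S → Contra ℰ S
  c-and0 : ∀ {Q R} → (land Q R , false) ∈ S → (Q , true) ∈ S → (R , true) ∈ S → Contra ℰ S
  c-and1l : ∀ {Q R} → (land Q R , true) ∈ S → (Q , false) ∈ S → Contra ℰ S
  c-and1r : ∀ {Q R} → (land Q R , true) ∈ S → (R , false) ∈ S → Contra ℰ S
  c-ext  : ∀ {b} (i : Fin (length ℰ)) → (ext (toℕ i) , b) ∈ S → (lookup ℰ i , not b) ∈ S → Contra ℰ S
  c-sim  : ∀ {A B} → IsENDT A → IsENDT B → Sim ℰ A B →
           (A , false) ∈ S → (B , true) ∈ S → Contra ℰ S

data Strategy (ℰ : ExtAxioms) : State → Set where
  leaf  : ∀ {S} → Contra ℰ S → Strategy ℰ S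
  query : ∀ {S} (q : Tm) → IsDM q →
          Strategy ℰ ((q , false) ∷ S) → Strategy ℰ ((q , true) ∷ S) → Strategy ℰ S

rounds : ∀ {ℰ S} → Strategy ℰ S → ℕ
rounds (leaf _) = 0
rounds (query _ _ l r) = suc (rounds l ⊔ rounds r)

-- De Morgan translation.  dm Q = Q^DM and dmNeg Q = (¬Q)^DM.
-- The eNDT clauses  B^DM = B  and  (¬B)^DM = ¬B  take priority.

mutual
  dm : Tm → Tm
  dm t = if isE t then t else dm′ t

  dm′ : Tm → Tm
  dm′ (land Q R) = land (dm Q) (dm R)
  dm′ (lor Q R)  = lor (dm Q) (dm R)
  dm′ (lneg Q)   = dmNeg Q
  dm′ t          = t

  dmNeg : Tm → Tm
  dmNeg t = if isE t then lneg t else dmNeg′ t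

  dmNeg′ : Tm → Tm
  dmNeg′ (lneg Q)   = dm Q
  dmNeg′ (lor Q R)  = land (dmNeg Q) (dmNeg R)
  dmNeg′ (land Q R) = lor (dmNeg Q) (dmNeg R)
  dmNeg′ t          = lneg t

-- |Q|_eNDT : number of occurrences of maximal eNDT subformulas
mutual
  sizeE : Tm → ℕ
  sizeE t = if isE t then 1 else sizeE′ t

  sizeE′ : Tm → ℕ
  sizeE′ (lneg Q)   = sizeE Q
  sizeE′ (lor Q R)  = sizeE Q + sizeE R
  sizeE′ (land Q R) = sizeE Q + sizeE R
  sizeE′ t          = 1

-- Q^DM and (¬Q)^DM are mirror images: the same tree with dual connectives and
-- complementary literals at the leaves.  If both are given the same value b,
-- pick a centroid node, i.e. one whose two subtrees have at most n/2 leaves each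
-- but more than n/2 together.  Query both sides of each subtree: if they agree we
-- are in a smaller instance of the same situation; otherwise they are settled,
-- and querying the node and its dual either contradicts a truth table or settles
-- the node too.  Collapsing the settled node to a single leaf leaves at most n/2
-- leaves, so six rounds halve the tree and O(log n) rounds win.
module Submission where

open import Defs
open import Data.Nat using (ℕ; _*_; _+_; _≤_)
open import Data.Nat.Logarithm using (⌊log₂_⌋)
open import Data.Bool using (Bool)
open import Data.Product using (Σ; _×_; _,_)
open import Data.List using (_∷_; [])

open import Data.Nat using (zero; suc; _<_; _^_; _≤?_; z≤n; s≤s)
open import Data.Nat.Properties
  using ( ≤-refl; ≤-trans; <-irrefl; <⇒≤; <⇒≱; ≰⇒>; n≤1+n; m≤m+n; m≤n+m; ⊔-lub; +-assoc
        ; +-identityʳ; +-mono-≤; +-monoʳ-≤; +-cancelʳ-≤; *-suc; *-monoʳ-≤; m^n>0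
        ; +-commutativeSemigroup; module ≤-Reasoning )
open import Data.Nat.Logarithm using (⌊log₂⌋-mono-≤; ⌊log₂[2^n]⌋≡n)
open import Data.Bool using (true; false; not; _∧_; _∨_; T; _≟_)
open import Data.Bool.Properties using (not-involutive; not-¬; T-≡)
open import Data.Unit using (⊤; tt)
open import Data.Empty using (⊥; ⊥-elim)
open import Data.List.Membership.Propositional using (_∈_)
open import Data.List.Relation.Unary.Any using (here; there)
open import Data.List.Relation.Binary.Subset.Propositional using (_⊆_)
open import Data.List.Relation.Binary.Subset.Propositional.Properties using (⊆-refl; ⊆-trans)
open import Algebra.Properties.CommutativeSemigroup +-commutativeSemigroup using (xy∙z≈xz∙y)
open import Function.Bundles using (Equivalence)
open import Relation.Binary.PropositionalEquality
open import Relation.Nullary using (yes; no; contradiction)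

data Conn : Set where
  ∨ᶜ ∧ᶜ : Conn

dual : Conn → Conn
dual ∨ᶜ = ∧ᶜ
dual ∧ᶜ = ∨ᶜ

⟪_⟫ : Conn → Tm → Tm → Tm
⟪ ∨ᶜ ⟫ = lor
⟪ ∧ᶜ ⟫ = land

⟦_⟧ : Conn → Bool → Bool → Bool
⟦ ∨ᶜ ⟧ = _∨_
⟦ ∧ᶜ ⟧ = _∧_

deMorgan : ∀ k x y → ⟦ dual k ⟧ (not x) (not y) ≡ not (⟦ k ⟧ x y)
deMorgan ∨ᶜ true  y = refl
deMorgan ∨ᶜ false y = refl
deMorgan ∧ᶜ true  y = refl
deMorgan ∧ᶜ false y = refl

-- Dual S P N: P and N are mirror images whose leaves are complementary literals
-- or pairs of queries already given opposite values in S.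
data Dual (S : State) : Tm → Tm → Set where
  lit     : ∀ {A} → IsENDT A → Dual S A (lneg A)
  lit¬    : ∀ {A} → IsENDT A → Dual S (lneg A) A
  settled : ∀ {P N} (v : Bool) → IsDM P → IsDM N → (P , v) ∈ S → (N , not v) ∈ S → Dual S P N
  bin     : ∀ {P₁ N₁ P₂ N₂} (k : Conn) → Dual S P₁ N₁ → Dual S P₂ N₂ →
            Dual S (⟪ k ⟫ P₁ P₂) (⟪ dual k ⟫ N₁ N₂)

module _ {S : State} where

  size : ∀ {P N} → Dual S P N → ℕ
  size (bin k d₁ d₂) = size d₁ + size d₂
  size _             = 1

  1≤size : ∀ {P N} (d : Dual S P N) → 1 ≤ size d
  1≤size (lit _)             = ≤-refl
  1≤size (lit¬ _)            = ≤-refl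
  1≤size (settled _ _ _ _ _) = ≤-refl
  1≤size (bin k d₁ d₂)       = ≤-trans (1≤size d₁) (m≤m+n _ _)

  Unsettled : ∀ {P N} → Dual S P N → Set
  Unsettled (settled _ _ _ _ _) = ⊥
  Unsettled _                   = ⊤

  posIsDM : ∀ {P N} → Dual S P N → IsDM P
  negIsDM : ∀ {P N} → Dual S P N → IsDM N
  posIsDM (lit e)               = atom e
  posIsDM (lit¬ e)              = negA e
  posIsDM (settled _ p _ _ _)   = p
  posIsDM (bin ∨ᶜ d₁ d₂)        = or (posIsDM d₁) (posIsDM d₂)
  posIsDM (bin ∧ᶜ d₁ d₂)        = and (posIsDM d₁) (posIsDM d₂)
  negIsDM (lit e)               = negA e
  negIsDM (lit¬ e)              = atom e
  negIsDM (settled _ _ n _ _)   = n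
  negIsDM (bin ∨ᶜ d₁ d₂)        = and (negIsDM d₁) (negIsDM d₂)
  negIsDM (bin ∧ᶜ d₁ d₂)        = or (negIsDM d₁) (negIsDM d₂)

  swap : ∀ {P N} → Dual S P N → Dual S N P
  swap (lit e)                     = lit¬ e
  swap (lit¬ e)                    = lit e
  swap {P} (settled v p n mp mn)   =
    settled (not v) n p mn (subst (λ u → (P , u) ∈ S) (sym (not-involutive v)) mp)
  swap (bin ∨ᶜ d₁ d₂)              = bin ∧ᶜ (swap d₁) (swap d₂)
  swap (bin ∧ᶜ d₁ d₂)              = bin ∨ᶜ (swap d₁) (swap d₂)

  size-swap : ∀ {P N} (d : Dual S P N) → size (swap d) ≡ size d
  size-swap (lit _)             = refl
  size-swap (lit¬ _)            = refl
  size-swap (settled _ _ _ _ _) = refl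
  size-swap (bin ∨ᶜ d₁ d₂)      = cong₂ _+_ (size-swap d₁) (size-swap d₂)
  size-swap (bin ∧ᶜ d₁ d₂)      = cong₂ _+_ (size-swap d₁) (size-swap d₂)

  unsettled-swap : ∀ {P N} (d : Dual S P N) → Unsettled d → Unsettled (swap d)
  unsettled-swap (lit _)        _ = tt
  unsettled-swap (lit¬ _)       _ = tt
  unsettled-swap (bin ∨ᶜ _ _)   _ = tt
  unsettled-swap (bin ∧ᶜ _ _)   _ = tt

module _ {S S′ : State} (S⊆S′ : S ⊆ S′) where

  weaken : ∀ {P N} → Dual S P N → Dual S′ P N
  weaken (lit e)               = lit e
  weaken (lit¬ e)              = lit¬ e
  weaken (settled v p n mp mn) = settled v p n (S⊆S′ mp) (S⊆S′ mn)
  weaken (bin k d₁ d₂)         = bin k (weaken d₁) (weaken d₂)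

  size-weaken : ∀ {P N} (d : Dual S P N) → size (weaken d) ≡ size d
  size-weaken (lit _)             = refl
  size-weaken (lit¬ _)            = refl
  size-weaken (settled _ _ _ _ _) = refl
  size-weaken (bin k d₁ d₂)       = cong₂ _+_ (size-weaken d₁) (size-weaken d₂)

  unsettled-weaken : ∀ {P N} (d : Dual S P N) → Unsettled d → Unsettled (weaken d)
  unsettled-weaken (lit _)     _ = tt
  unsettled-weaken (lit¬ _)    _ = tt
  unsettled-weaken (bin _ _ _) _ = tt

data Ctx (S : State) (P′ N′ : Tm) : Tm → Tm → Set where
  hole  : Ctx S P′ N′ P′ N′
  left  : ∀ {P₁ N₁ P₂ N₂} (k : Conn) → Ctx S P′ N′ P₁ N₁ → Dual S P₂ N₂ →
          Ctx S P′ N′ (⟪ k ⟫ P₁ P₂) (⟪ dual k ⟫ N₁ N₂)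
  right : ∀ {P₁ N₁ P₂ N₂} (k : Conn) → Dual S P₁ N₁ → Ctx S P′ N′ P₂ N₂ →
          Ctx S P′ N′ (⟪ k ⟫ P₁ P₂) (⟪ dual k ⟫ N₁ N₂)

module _ {S : State} {P′ N′ : Tm} where

  plug : ∀ {P N} → Ctx S P′ N′ P N → Dual S P′ N′ → Dual S P N
  plug hole            t = t
  plug (left k c d)    t = bin k (plug c t) d
  plug (right k d c)   t = bin k d (plug c t)

  ctxSize : ∀ {P N} → Ctx S P′ N′ P N → ℕ
  ctxSize hole          = 0
  ctxSize (left k c d)  = ctxSize c + size d
  ctxSize (right k d c) = size d + ctxSize c

  size-plug : ∀ {P N} (c : Ctx S P′ N′ P N) (t : Dual S P′ N′) → size (plug c t) ≡ ctxSize c + size t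
  size-plug hole          t = refl
  size-plug (left k c d)  t =
    trans (cong (_+ size d) (size-plug c t)) (xy∙z≈xz∙y (ctxSize c) (size t) (size d))
  size-plug (right k d c) t =
    trans (cong (size d +_) (size-plug c t)) (sym (+-assoc (size d) (ctxSize c) (size t)))

module _ {S S′ : State} (S⊆S′ : S ⊆ S′) {P′ N′ : Tm} where

  weakenCtx : ∀ {P N} → Ctx S P′ N′ P N → Ctx S′ P′ N′ P N
  weakenCtx hole          = hole
  weakenCtx (left k c d)  = left k (weakenCtx c) (weaken S⊆S′ d)
  weakenCtx (right k d c) = right k (weaken S⊆S′ d) (weakenCtx c)

  ctxSize-weaken : ∀ {P N} (c : Ctx S P′ N′ P N) → ctxSize (weakenCtx c) ≡ ctxSize c
  ctxSize-weaken hole          = refl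
  ctxSize-weaken (left k c d)  = cong₂ _+_ (ctxSize-weaken c) (size-weaken S⊆S′ d)
  ctxSize-weaken (right k d c) = cong₂ _+_ (size-weaken S⊆S′ d) (ctxSize-weaken c)

data Centroid (B : ℕ) (S : State) (P N : Tm) (n : ℕ) : Set where
  centroid : ∀ {k P₁ N₁ P₂ N₂} (d₁ : Dual S P₁ N₁) (d₂ : Dual S P₂ N₂)
             (c : Ctx S (⟪ k ⟫ P₁ P₂) (⟪ dual k ⟫ N₁ N₂) P N) →
             size d₁ ≤ B → size d₂ ≤ B → B < size d₁ + size d₂ →
             ctxSize c + (size d₁ + size d₂) ≡ n → Centroid B S P N n

findCentroid : ∀ {S P N} B → 1 ≤ B → (d : Dual S P N) → B < size d → Centroid B S P N (size d)
findCentroid B 1≤B (lit _)             B<1 = contradiction 1≤B (<⇒≱ B<1)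
findCentroid B 1≤B (lit¬ _)            B<1 = contradiction 1≤B (<⇒≱ B<1)
findCentroid B 1≤B (settled _ _ _ _ _) B<1 = contradiction 1≤B (<⇒≱ B<1)
findCentroid B 1≤B (bin k d₁ d₂) B<n with size d₁ ≤? B | size d₂ ≤? B
... | yes d₁≤B | yes d₂≤B = centroid d₁ d₂ hole d₁≤B d₂≤B B<n refl
... | no d₁≰B | _ with findCentroid B 1≤B d₁ (≰⇒> d₁≰B)
...   | centroid e₁ e₂ c e₁≤B e₂≤B B<e size≡ =
  centroid e₁ e₂ (left k c d₂) e₁≤B e₂≤B B<e
    (trans (xy∙z≈xz∙y (ctxSize c) (size d₂) _) (cong (_+ size d₂) size≡))
findCentroid B 1≤B (bin k d₁ d₂) B<n | yes _ | no d₂≰B with findCentroid B 1≤B d₂ (≰⇒> d₂≰B)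
...   | centroid e₁ e₂ c e₁≤B e₂≤B B<e size≡ =
  centroid e₁ e₂ (right k d₁ c) e₁≤B e₂≤B B<e
    (trans (+-assoc (size d₁) (ctxSize c) _) (cong (size d₁ +_) size≡))

ctx+1≤half : ∀ {c m n B} → c + m ≡ n → n ≤ 2 * B → B < m → c + 1 ≤ B
ctx+1≤half {c} {m} {n} {B} c+m≡n n≤2B B<m = +-cancelʳ-≤ B (c + 1) B (begin
  c + 1 + B    ≡⟨ +-assoc c 1 B ⟩
  c + suc B    ≤⟨ +-monoʳ-≤ c B<m ⟩
  c + m        ≡⟨ c+m≡n ⟩
  n            ≤⟨ n≤2B ⟩
  2 * B        ≡⟨ cong (B +_) (+-identityʳ B) ⟩
  B + B        ∎)
  where open ≤-Reasoning

module Game (ℰ : ExtAxioms) where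

  Win : State → ℕ → Set
  Win S k = Σ (Strategy ℰ S) λ σ → rounds σ ≤ k

  win-mono : ∀ {S k k′} → k ≤ k′ → Win S k → Win S k′
  win-mono k≤k′ (σ , σ≤k) = σ , ≤-trans σ≤k k≤k′

  refute : ∀ {S k} → Contra ℰ S → Win S k
  refute c = leaf c , z≤n

  ask : ∀ {S k} (q : Tm) → IsDM q → ((x : Bool) → Win ((q , x) ∷ S) k) → Win S (suc k)
  ask q q-dm next with next false | next true
  ... | σ₀ , σ₀≤k | σ₁ , σ₁≤k = query q q-dm σ₀ σ₁ , s≤s (⊔-lub σ₀≤k σ₁≤k)

  ∨-mismatch : ∀ {S X Y u x y} → (lor X Y , u) ∈ S → (X , x) ∈ S → (Y , y) ∈ S →
               u ≢ x ∨ y → Contra ℰ S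
  ∨-mismatch {u = true}  {x = false} {y = false} m mx my _ = c-or1 m mx my
  ∨-mismatch {u = false} {x = true}              m mx _  _ = c-or0l m mx
  ∨-mismatch {u = false} {x = false} {y = true}  m _  my _ = c-or0r m my
  ∨-mismatch {u = true}  {x = true}              _ _  _  u≢ = ⊥-elim (u≢ refl)
  ∨-mismatch {u = true}  {x = false} {y = true}  _ _  _  u≢ = ⊥-elim (u≢ refl)
  ∨-mismatch {u = false} {x = false} {y = false} _ _  _  u≢ = ⊥-elim (u≢ refl)

  ∧-mismatch : ∀ {S X Y u x y} → (land X Y , u) ∈ S → (X , x) ∈ S → (Y , y) ∈ S →
               u ≢ x ∧ y → Contra ℰ S
  ∧-mismatch {u = false} {x = true}  {y = true}  m mx my _ = c-and0 m mx my
  ∧-mismatch {u = true}  {x = false}             m mx _  _ = c-and1l m mx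
  ∧-mismatch {u = true}  {x = true}  {y = false} m _  my _ = c-and1r m my
  ∧-mismatch {u = false} {x = false}             _ _  _  u≢ = ⊥-elim (u≢ refl)
  ∧-mismatch {u = false} {x = true}  {y = false} _ _  _  u≢ = ⊥-elim (u≢ refl)
  ∧-mismatch {u = true}  {x = true}  {y = true}  _ _  _  u≢ = ⊥-elim (u≢ refl)

  conn-mismatch : ∀ k {S X Y u x y} → (⟪ k ⟫ X Y , u) ∈ S → (X , x) ∈ S → (Y , y) ∈ S →
                  u ≢ ⟦ k ⟧ x y → Contra ℰ S
  conn-mismatch ∨ᶜ = ∨-mismatch
  conn-mismatch ∧ᶜ = ∧-mismatch

  node-dual-contra : ∀ {S k P₁ N₁ P₂ N₂ v₁ v₂ b} →
    (P₁ , v₁) ∈ S → (N₁ , not v₁) ∈ S → (P₂ , v₂) ∈ S → (N₂ , not v₂) ∈ S →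
    (⟪ k ⟫ P₁ P₂ , b) ∈ S → (⟪ dual k ⟫ N₁ N₂ , b) ∈ S → Contra ℰ S
  node-dual-contra {k = k} {v₁ = v₁} {v₂} {b} p₁ n₁ p₂ n₂ p n with b ≟ ⟦ k ⟧ v₁ v₂
  ... | no b≢  = conn-mismatch k p p₁ p₂ b≢
  ... | yes refl =
    conn-mismatch (dual k) n n₁ n₂ (λ b≡ → not-¬ refl (trans b≡ (deMorgan k v₁ v₂)))

  OnceSettled : State → Tm → Tm → ℕ → Set
  OnceSettled S P N K = ∀ {S′} → S ⊆ S′ → (v : Bool) → (P , v) ∈ S′ → (N , not v) ∈ S′ → Win S′ K

  settleNode : ∀ {S k P₁ N₁ P₂ N₂ v₁ v₂ K} →
    IsDM (⟪ k ⟫ P₁ P₂) → IsDM (⟪ dual k ⟫ N₁ N₂) →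
    (P₁ , v₁) ∈ S → (N₁ , not v₁) ∈ S → (P₂ , v₂) ∈ S → (N₂ , not v₂) ∈ S →
    OnceSettled S (⟪ k ⟫ P₁ P₂) (⟪ dual k ⟫ N₁ N₂) K → Win S (2 + K)
  settleNode {S} {k} {P₁} {N₁} {P₂} {N₂} {v₁} {v₂} {K} p-dm n-dm p₁ n₁ p₂ n₂ next =
    ask _ p-dm λ u → ask _ n-dm λ w → answer u w
    where
    answer : ∀ u w → Win ((⟪ dual k ⟫ N₁ N₂ , w) ∷ (⟪ k ⟫ P₁ P₂ , u) ∷ S) K
    answer u w with u ≟ ⟦ k ⟧ v₁ v₂ | w ≟ not u
    ... | no u≢ | _ =
      refute (conn-mismatch k (there (here refl)) (there (there p₁)) (there (there p₂)) u≢)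
    ... | yes refl | no w≢ =
      refute (conn-mismatch (dual k) (here refl) (there (there n₁)) (there (there n₂))
                (λ w≡ → w≢ (trans w≡ (deMorgan k v₁ v₂))))
    ... | yes _ | yes refl = next (λ m → there (there m)) u (there (here refl)) (here refl)

  -- A settled root is excluded: it would give P and N two values each, which is
  -- not a simple contradiction.
  Solvable : ℕ → Set
  Solvable j = ∀ {S P N} (d : Dual S P N) → Unsettled d → size d ≤ 2 ^ j →
               ∀ b → (P , b) ∈ S → (N , b) ∈ S → Win S (6 * j)

  module Halving (j : ℕ) (solvable : Solvable j) where

    settleUnsettled : ∀ {S P N K} (d : Dual S P N) → Unsettled d → size d ≤ 2 ^ j → 6 * j ≤ K →
                      OnceSettled S P N K → Win S (2 + K)
    settleUnsettled {S} {P} {N} {K} d unsettled d≤ 6j≤K next =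
      ask P (posIsDM d) λ x → ask N (negIsDM d) λ y → answer x y
      where
      extend : ∀ {x y} → S ⊆ ((N , y) ∷ (P , x) ∷ S)
      extend m = there (there m)
      agree : ∀ b → Win ((N , b) ∷ (P , b) ∷ S) K
      agree b = win-mono 6j≤K
        (solvable (weaken extend d) (unsettled-weaken extend d unsettled)
          (subst (_≤ 2 ^ j) (sym (size-weaken extend d)) d≤) b (there (here refl)) (here refl))
      answer : ∀ x y → Win ((N , y) ∷ (P , x) ∷ S) K
      answer false false = agree false
      answer true  true  = agree true
      answer false true  = next extend false (there (here refl)) (here refl)
      answer true  false = next extend true (there (here refl)) (here refl)

    settle : ∀ {S P N K} (d : Dual S P N) → size d ≤ 2 ^ j → 6 * j ≤ K →
             OnceSettled S P N K → Win S (2 + K)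
    settle (settled v _ _ p n) _ _ next = win-mono (m≤n+m _ 2) (next ⊆-refl v p n)
    settle d@(lit _)     = settleUnsettled d tt
    settle d@(lit¬ _)    = settleUnsettled d tt
    settle d@(bin _ _ _) = settleUnsettled d tt

    collapse : ∀ {S k P₁ N₁ P₂ N₂ P N v₁ v₂ b} (c : Ctx S (⟪ k ⟫ P₁ P₂) (⟪ dual k ⟫ N₁ N₂) P N) →
      (∀ {S′} (S⊆S′ : S ⊆ S′) t → Unsettled (plug (weakenCtx S⊆S′ c) t)) →
      ctxSize c + 1 ≤ 2 ^ j → IsDM (⟪ k ⟫ P₁ P₂) → IsDM (⟪ dual k ⟫ N₁ N₂) →
      (P₁ , v₁) ∈ S → (N₁ , not v₁) ∈ S → (P₂ , v₂) ∈ S → (N₂ , not v₂) ∈ S →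
      (P , b) ∈ S → (N , b) ∈ S → Win S (2 + 6 * j)
    collapse {b = b} c unsettled c+1≤ p-dm n-dm p₁ n₁ p₂ n₂ p n =
      settleNode p-dm n-dm p₁ n₁ p₂ n₂ λ S⊆S′ v pv nv →
        let t = settled v p-dm n-dm pv nv in
        solvable (plug (weakenCtx S⊆S′ c) t) (unsettled S⊆S′ t)
          (subst (_≤ 2 ^ j)
            (sym (trans (size-plug (weakenCtx S⊆S′ c) t) (cong (_+ 1) (ctxSize-weaken S⊆S′ c))))
            c+1≤)
          b (S⊆S′ p) (S⊆S′ n)

    collapseOrRefute : ∀ {S k P₁ N₁ P₂ N₂ P N v₁ v₂ b} (c : Ctx S (⟪ k ⟫ P₁ P₂) (⟪ dual k ⟫ N₁ N₂) P N) →
      ctxSize c + 1 ≤ 2 ^ j → IsDM (⟪ k ⟫ P₁ P₂) → IsDM (⟪ dual k ⟫ N₁ N₂) →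
      (P₁ , v₁) ∈ S → (N₁ , not v₁) ∈ S → (P₂ , v₂) ∈ S → (N₂ , not v₂) ∈ S →
      (P , b) ∈ S → (N , b) ∈ S → Win S (2 + 6 * j)
    collapseOrRefute hole _ _ _ p₁ n₁ p₂ n₂ p n = refute (node-dual-contra p₁ n₁ p₂ n₂ p n)
    collapseOrRefute c@(left _ _ _)  = collapse c λ _ _ → tt
    collapseOrRefute c@(right _ _ _) = collapse c λ _ _ → tt

    halve : ∀ {S P N n} → n ≤ 2 ^ suc j → ∀ b → (P , b) ∈ S → (N , b) ∈ S →
            Centroid (2 ^ j) S P N n → Win S (6 + 6 * j)
    halve n≤ b p n (centroid {k} d₁ d₂ c d₁≤ d₂≤ half<d₁+d₂ size≡) =
      settle d₁ d₁≤ (m≤n+m _ 4) λ S⊆S′ v₁ p₁ n₁ →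
      settle (weaken S⊆S′ d₂) (subst (_≤ 2 ^ j) (sym (size-weaken S⊆S′ d₂)) d₂≤) (m≤n+m _ 2)
        λ S′⊆S″ v₂ p₂ n₂ →
      let S⊆S″ = ⊆-trans S⊆S′ S′⊆S″ in
      collapseOrRefute (weakenCtx S⊆S″ c)
        (subst (λ m → m + 1 ≤ 2 ^ j) (sym (ctxSize-weaken S⊆S″ c)) (ctx+1≤half size≡ n≤ half<d₁+d₂))
        (posIsDM (bin k d₁ d₂)) (negIsDM (bin k d₁ d₂))
        (S′⊆S″ p₁) (S′⊆S″ n₁) p₂ n₂ (S⊆S″ p) (S⊆S″ n)

  solve : ∀ j → Solvable j
  solve zero (lit _)  _ _ _ p n = refute (c-neg p n)
  solve zero (lit¬ _) _ _ _ p n = refute (c-neg n p)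
  solve zero (bin k d₁ d₂) _ d≤1 =
    contradiction (≤-trans (+-mono-≤ (1≤size d₁) (1≤size d₂)) d≤1) λ { (s≤s ()) }
  solve (suc j) d unsettled d≤ b p n with size d ≤? 2 ^ j
  ... | yes d≤half = win-mono (*-monoʳ-≤ 6 (n≤1+n j)) (solve j d unsettled d≤half b p n)
  ... | no d≰half = subst (Win _) (sym (*-suc 6 j))
    (Halving.halve j (solve j) d≤ b p n (findCentroid (2 ^ j) (m^n>0 2 j) d (≰⇒> d≰half)))

DMTree : State → Tm → Set
DMTree S Q = Σ (Dual S (dm Q) (dmNeg Q)) λ d → Unsettled d × size d ≡ sizeE Q

dmTree-endt : ∀ {S A} → IsENDT A → DMTree S A
dmTree-endt A-endt rewrite Equivalence.to T-≡ A-endt =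
  lit A-endt , tt , refl

dmTree : ∀ {S Q} → IsNB Q → DMTree S Q
dmTree {Q = A} (atom A-endt) = dmTree-endt {A = A} A-endt
dmTree (neg q) with dmTree q
... | d , unsettled , size≡ = swap d , unsettled-swap d unsettled , trans (size-swap d) size≡
dmTree (and q r) with dmTree q | dmTree r
... | d₁ , _ , size≡₁ | d₂ , _ , size≡₂ = bin ∧ᶜ d₁ d₂ , tt , cong₂ _+_ size≡₁ size≡₂
dmTree {S} (or {Q} {R} q r) with isE Q ∧ isE R in endt
... | true  = lit (subst T (sym endt) tt) , tt , refl
... | false with dmTree {S} q | dmTree {S} r
...   | d₁ , _ , size≡₁ | d₂ , _ , size≡₂ = bin ∨ᶜ d₁ d₂ , tt , cong₂ _+_ size≡₁ size≡₂

n<2^suc⌊log₂n⌋ : ∀ n → n < 2 ^ suc ⌊log₂ n ⌋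
n<2^suc⌊log₂n⌋ n with 2 ^ suc ⌊log₂ n ⌋ ≤? n
... | no 2^≰n = ≰⇒> 2^≰n
... | yes 2^≤n = contradiction
  (subst (_≤ ⌊log₂ n ⌋) (⌊log₂[2^n]⌋≡n (suc ⌊log₂ n ⌋)) (⌊log₂⌋-mono-≤ 2^≤n)) (<-irrefl refl)

-- The strategy only ever uses the De Morgan and truth-table contradictions.
lemma6p6 : Σ ℕ λ c → (ℰ : ExtAxioms) → WellFormed ℰ → (Q : Tm) → IsNB Q → (b : Bool) →
    Σ (Strategy ℰ ((dm Q , b) ∷ (dmNeg Q , b) ∷ [])) λ σ →
      rounds σ ≤ c * (1 + ⌊log₂ sizeE Q ⌋)
lemma6p6 = 6 , λ ℰ _ Q q b →
  let d , unsettled , size≡ = dmTree q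
  in Game.solve ℰ (suc ⌊log₂ sizeE Q ⌋) d unsettled
       (subst (_≤ 2 ^ suc ⌊log₂ sizeE Q ⌋) (sym size≡) (<⇒≤ (n<2^suc⌊log₂n⌋ (sizeE Q))))
       b (here refl) (there (here refl))
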